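{- Let $q \in \mathbb{C}$ be non-zero, and let $\mathrm{Conv}_h(q,z) = P_h(q,z)/Q_h(q,z)$ be the $h$-th convergent function defined in the context below. Then for all integers $h \geq 1$ and every integer $0 \leq n \leq h$, the coefficient of $z^n$ in the power series expansion of $\mathrm{Conv}_h(q,z)$ about $z=0$ equals $q^{n^2}$, i.e. $[z^n]\,\mathrm{Conv}_h(q,z) = q^{n^2}$.
   Context: For a fixed non-zero $q \in \mathbb{C}$ define, for integers $h \geq 0$, $c_h(q) = q^{2h-3}(q^{2h}+q^{2h-2}-1)$ if $h \geq 2$, $c_1(q) = q$, $c_0(q) = 1$; and $\alpha_h(q) = q^{6h-10}(q^{2h-2}-1)$ if $h \geq 2$, $\alpha_h(q)=0$ otherwise. Define polynomials in $z$ by $P_0(q,z)=0$, $P_1(q,z)=1$, $Q_0(q,z)=1$, $Q_1(q,z)=1-qz$, and for $h \geq 2$: $P_h(q,z) = (1-c_h(q) z)P_{h-1}(q,z) - \alpha_h(q) z^2 P_{h-2}(q,z)$, $Q_h(q,z) = (1-c_h(q) z)Q_{h-1}(q,z) - \alpha_h(q) z^2 Q_{h-2}(q,z)$. The $h$-th convergent function is the rational function $\mathrm{Conv}_h(q,z) = P_h(q,z)/Q_h(q,z)$ (these are the convergents of the continued fraction $1/(1-c_1 z - \alpha_2 z^2/(1-c_2 z - \alpha_3 z^2/(1-c_3 z-\cdots)))$). Since $Q_h(q,0)=1$, it has a power series expansion in $z$ about $0$, and $[z^n]F$ denotes the coefficient of $z^n$ in such an expansion. -}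

module Defs where

open import Level using (Level)
open import Data.Nat using (ℕ; zero; suc) renaming (_+_ to _+ℕ_; _*_ to _*ℕ_)
open import Data.List using (List; []; _∷_)
open import Algebra.Bundles using (CommutativeRing)

-- All definitions are over an arbitrary commutative ring R (the paper uses ℂ).
-- A polynomial / formal power series in z is represented by its coefficient
-- function ℕ → Carrier  (k ↦ [z^k]).
module _ {c ℓ : Level} (R : CommutativeRing c ℓ) where
  open CommutativeRing R hiding (zero)

  pow : Carrier → ℕ → Carrier
  pow x zero    = 1#
  pow x (suc n) = x * pow x n

  cc : Carrier → ℕ → Carrier
  cc q zero          = 1#
  cc q (suc zero)    = q
  cc q (suc (suc k)) =            -- h = k + 2 : q^{2h-3}(q^{2h}+q^{2h-2}-1)
    pow q (2 *ℕ k +ℕ 1) * (pow q (2 *ℕ k +ℕ 4) + pow q (2 *ℕ k +ℕ 2) - 1#)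

  αα : Carrier → ℕ → Carrier
  αα q zero          = 0#
  αα q (suc zero)    = 0#
  αα q (suc (suc k)) =            -- h = k + 2 : q^{6h-10}(q^{2h-2}-1)
    pow q (6 *ℕ k +ℕ 2) * (pow q (2 *ℕ k +ℕ 2) - 1#)

  shiftZ : (ℕ → Carrier) → ℕ → Carrier
  shiftZ f zero    = 0#
  shiftZ f (suc m) = f m

  -- the three-term recurrence
  --   X_h = (1 - c_h z) X_{h-1} - α_h z² X_{h-2}   (h ≥ 2)
  -- with initial polynomials X_0 = a, X_1 = b.
  step : Carrier → ℕ → (ℕ → Carrier) → (ℕ → Carrier) → ℕ → Carrier
  step q h X₁ X₀ m = X₁ m - cc q h * shiftZ X₁ m - αα q h * shiftZ (shiftZ X₀) m

  recur : Carrier → (ℕ → Carrier) → (ℕ → Carrier) → ℕ → ℕ → Carrier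
  recur q a b zero          = a
  recur q a b (suc zero)    = b
  recur q a b (suc (suc k)) =
    step q (suc (suc k)) (recur q a b (suc k)) (recur q a b k)

  zeroPoly : ℕ → Carrier
  zeroPoly _ = 0#

  onePoly : ℕ → Carrier
  onePoly zero    = 1#
  onePoly (suc _) = 0#

  oneMinusQz : Carrier → ℕ → Carrier
  oneMinusQz q zero          = 1#
  oneMinusQz q (suc zero)    = - q
  oneMinusQz q (suc (suc _)) = 0#

  Ppoly : Carrier → ℕ → ℕ → Carrier
  Ppoly q = recur q zeroPoly onePoly

  Qpoly : Carrier → ℕ → ℕ → Carrier
  Qpoly q = recur q onePoly (oneMinusQz q)

  -- Power series expansion about z = 0 of P/Q, for Q with constant term 1:
  -- the unique series f with Q·f = P, i.e.
  --   f_0 = p_0,   f_n = p_n - Σ_{i=1}^{n} Q_i f_{n-i}.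
  -- conv Q i [x₀, x₁, …] = Σ_j Q_{i+j} x_j
  conv : (ℕ → Carrier) → ℕ → List Carrier → Carrier
  conv Qc i []       = 0#
  conv Qc i (x ∷ xs) = Qc i * x + conv Qc (suc i) xs

  -- quotCoeffs P Q n = [f_n, f_{n-1}, …, f_0]
  quotCoeffs : (ℕ → Carrier) → (ℕ → Carrier) → ℕ → List Carrier
  quotCoeffs Pc Qc zero    = Pc zero ∷ []
  quotCoeffs Pc Qc (suc n) =
    (Pc (suc n) - conv Qc 1 prev) ∷ prev
    where prev = quotCoeffs Pc Qc n

  head0 : List Carrier → Carrier
  head0 []      = 0#
  head0 (x ∷ _) = x

  seriesCoeff : (ℕ → Carrier) → (ℕ → Carrier) → ℕ → Carrier
  seriesCoeff Pc Qc n = head0 (quotCoeffs Pc Qc n)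

  convCoeff : Carrier → ℕ → ℕ → Carrier
  convCoeff q h n = seriesCoeff (Ppoly q h) (Qpoly q h) n

-- Write F(z) = Σ_n q^{n²} z^n and t = q².  The proof has three steps.
-- (1) Closed form of the denominators: [z^m] Q_h = (-1)^m q^{m(2h-1)} [h, m]_t,
--     where [h, m]_t is the Gaussian binomial coefficient.  It satisfies the
--     recurrence of the Q_h thanks to a three-term identity for Gaussian
--     binomials, derived from the t-Pascal rule, its mirror image and absorption.
-- (2) Q_h · F agrees with P_h up to degree h.  Below degree h this propagates
--     along the recurrence shared by P_h and Q_h, as [z^n] (Q · F) is linear in Q.
--     In degree h, P_h has no term, and [z^h] (Q_h · F) is q^{h²} times
--     Σ_j (-1)^j t^{j(j-1)/2} [h, j]_t, a telescoping sum equal to 0.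
-- (3) As Q_h(0) = 1, agreement up to degree h forces the series of P_h / Q_h
--     to have the coefficients of F up to degree h.

module Submission where

open import Defs
open import Level using (Level)
open import Algebra.Bundles using (CommutativeRing; RawRing)
open import Data.Nat as ℕ using (ℕ; zero; suc; _≤_; _<_; z≤n; s≤s) renaming (_*_ to _*ℕ_)
open import Data.Nat.Properties as ℕP using (+-suc)
open import Data.Nat.Tactic.RingSolver using (solve-∀)
open import Data.Integer as ℤ using (ℤ; +_; -[1+_]; _⊖_; _◃_; sign; ∣_∣)
open import Data.Integer.Properties using ([1+m]⊖[1+n]≡m⊖n)
open import Data.Sign as Sign using (Sign)
open import Data.List using (List; []; _∷_)
open import Data.List.Relation.Binary.Pointwise using (Pointwise; []; _∷_)
open import Data.Maybe using (Maybe; just; nothing)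
open import Data.Sum using (inj₁; inj₂)
open import Relation.Nullary using (¬_; yes; no)
import Relation.Binary.PropositionalEquality as ≡

-- The ring solver of the library, instantiated for an arbitrary commutative
-- ring with integer coefficients: the canonical map ℤ → R is a ring morphism.
module IntegerSolver {c ℓ : Level} (R : CommutativeRing c ℓ) where
  open CommutativeRing R
  open import Algebra.Properties.Ring ring using (-‿distribˡ-*; -‿involutive; -0#≈0#; -‿+-comm)
  open import Algebra.Properties.CommutativeSemigroup *-commutativeSemigroup using (x∙yz≈y∙xz)
  open import Algebra.Properties.Semiring.Mult.TCOptimised semiring using (_×_; 1+×; ×-homo-+; ×1-homo-*)
  open import Algebra.Solver.Ring.AlmostCommutativeRing using (fromCommutativeRing; _-Raw-AlmostCommutative⟶_)
  open import Relation.Binary.Reasoning.Setoid setoid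

  ⟪_⟫ : ℤ → Carrier
  ⟪ + n ⟫     = n × 1#
  ⟪ -[1+ n ] ⟫ = - (suc n × 1#)

  sub-cancel-1 : ∀ a b → (1# + a) - (1# + b) ≈ a - b
  sub-cancel-1 a b = begin
    (1# + a) + - (1# + b)    ≈⟨ +-congˡ (-‿+-comm 1# b) ⟨
    (1# + a) + (- 1# + - b)  ≈⟨ +-assoc 1# a _ ⟩
    1# + (a + (- 1# + - b))  ≈⟨ +-congˡ (+-congˡ (+-comm (- 1#) (- b))) ⟩
    1# + (a + (- b + - 1#))  ≈⟨ +-congˡ (+-assoc a (- b) (- 1#)) ⟨
    1# + ((a - b) + - 1#)    ≈⟨ +-comm 1# _ ⟩
    ((a - b) + - 1#) + 1#    ≈⟨ +-assoc (a - b) (- 1#) 1# ⟩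
    (a - b) + (- 1# + 1#)    ≈⟨ +-congˡ (-‿inverseˡ 1#) ⟩
    (a - b) + 0#             ≈⟨ +-identityʳ _ ⟩
    a - b                    ∎

  ⊖-homo : ∀ m n → ⟪ m ⊖ n ⟫ ≈ m × 1# - n × 1#
  ⊖-homo zero    zero    = sym (trans (+-congˡ -0#≈0#) (+-identityʳ 0#))
  ⊖-homo zero    (suc n) = sym (+-identityˡ _)
  ⊖-homo (suc m) zero    = sym (trans (+-congˡ -0#≈0#) (+-identityʳ _))
  ⊖-homo (suc m) (suc n) rewrite [1+m]⊖[1+n]≡m⊖n m n =
    trans (⊖-homo m n) (sym (trans (+-cong (1+× m 1#) (-‿cong (1+× n 1#))) (sub-cancel-1 (m × 1#) (n × 1#))))

  +-homo : ∀ i j → ⟪ i ℤ.+ j ⟫ ≈ ⟪ i ⟫ + ⟪ j ⟫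
  +-homo (+ m)    (+ n)    = ×-homo-+ 1# m n
  +-homo (+ m)    -[1+ n ] = ⊖-homo m (suc n)
  +-homo -[1+ m ] (+ n)    = trans (⊖-homo n (suc m)) (+-comm _ _)
  +-homo -[1+ m ] -[1+ n ] = begin
    - (suc (suc (m ℕ.+ n)) × 1#)    ≈⟨ -‿cong (reflexive (≡.cong (λ k → suc k × 1#) (+-suc m n))) ⟨
    - ((suc m ℕ.+ suc n) × 1#)      ≈⟨ -‿cong (×-homo-+ 1# (suc m) (suc n)) ⟩
    - (suc m × 1# + suc n × 1#)     ≈⟨ -‿+-comm _ _ ⟨
    - (suc m × 1#) + - (suc n × 1#) ∎

  ⟪_⟫ₛ : Sign → Carrier
  ⟪ Sign.+ ⟫ₛ = 1#
  ⟪ Sign.- ⟫ₛ = - 1#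

  minus-as-sign : ∀ x → - x ≈ - 1# * x
  minus-as-sign x = trans (-‿cong (sym (*-identityˡ x))) (-‿distribˡ-* 1# x)

  ◃-homo : ∀ s n → ⟪ s ◃ n ⟫ ≈ ⟪ s ⟫ₛ * (n × 1#)
  ◃-homo s      zero    = sym (zeroʳ _)
  ◃-homo Sign.+ (suc n) = sym (*-identityˡ _)
  ◃-homo Sign.- (suc n) = minus-as-sign _

  sign-abs-homo : ∀ i → ⟪ i ⟫ ≈ ⟪ sign i ⟫ₛ * (∣ i ∣ × 1#)
  sign-abs-homo (+ n)    = sym (*-identityˡ _)
  sign-abs-homo -[1+ n ] = minus-as-sign _

  sign-*-homo : ∀ s t → ⟪ s Sign.* t ⟫ₛ ≈ ⟪ s ⟫ₛ * ⟪ t ⟫ₛ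
  sign-*-homo Sign.+ t      = sym (*-identityˡ _)
  sign-*-homo Sign.- Sign.+ = sym (*-identityʳ _)
  sign-*-homo Sign.- Sign.- = begin
    1#            ≈⟨ -‿involutive 1# ⟨
    - - 1#        ≈⟨ minus-as-sign (- 1#) ⟩
    - 1# * - 1#   ∎

  interchange : ∀ a b x y → (a * b) * (x * y) ≈ (a * x) * (b * y)
  interchange a b x y = begin
    (a * b) * (x * y)  ≈⟨ *-assoc a b _ ⟩
    a * (b * (x * y))  ≈⟨ *-congˡ (x∙yz≈y∙xz b x y) ⟩
    a * (x * (b * y))  ≈⟨ *-assoc a x _ ⟨
    (a * x) * (b * y)  ∎

  *-homo : ∀ i j → ⟪ i ℤ.* j ⟫ ≈ ⟪ i ⟫ * ⟪ j ⟫
  *-homo i j = begin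
    ⟪ (sign i Sign.* sign j) ◃ (∣ i ∣ ℕ.* ∣ j ∣) ⟫
      ≈⟨ ◃-homo (sign i Sign.* sign j) (∣ i ∣ ℕ.* ∣ j ∣) ⟩
    ⟪ sign i Sign.* sign j ⟫ₛ * ((∣ i ∣ ℕ.* ∣ j ∣) × 1#)
      ≈⟨ *-cong (sign-*-homo (sign i) (sign j)) (×1-homo-* ∣ i ∣ ∣ j ∣) ⟩
    (⟪ sign i ⟫ₛ * ⟪ sign j ⟫ₛ) * ((∣ i ∣ × 1#) * (∣ j ∣ × 1#))
      ≈⟨ interchange _ _ _ _ ⟩
    (⟪ sign i ⟫ₛ * (∣ i ∣ × 1#)) * (⟪ sign j ⟫ₛ * (∣ j ∣ × 1#))
      ≈⟨ *-cong (sign-abs-homo i) (sign-abs-homo j) ⟨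
    ⟪ i ⟫ * ⟪ j ⟫ ∎

  neg-homo : ∀ i → ⟪ ℤ.- i ⟫ ≈ - ⟪ i ⟫
  neg-homo -[1+ n ]  = sym (-‿involutive _)
  neg-homo (+ zero)  = sym -0#≈0#
  neg-homo (+ suc n) = refl

  ℤ-rawRing : RawRing _ _
  ℤ-rawRing = record
    { Carrier = ℤ ; _≈_ = ≡._≡_ ; _+_ = ℤ._+_ ; _*_ = ℤ._*_ ; -_ = ℤ.-_ ; 0# = + 0 ; 1# = + 1 }

  ℤ⟶R : ℤ-rawRing -Raw-AlmostCommutative⟶ fromCommutativeRing R
  ℤ⟶R = record
    { ⟦_⟧ = ⟪_⟫ ; +-homo = +-homo ; *-homo = *-homo ; -‿homo = neg-homo
    ; 0-homo = refl ; 1-homo = refl }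

  -- equal integers have equal images (used by the solver to detect zero coefficients)
  ⟪⟫-dec : ∀ i j → Maybe (⟪ i ⟫ ≈ ⟪ j ⟫)
  ⟪⟫-dec i j with i ℤ.≟ j
  ... | yes ≡.refl = just refl
  ... | no _       = nothing

  open import Algebra.Solver.Ring ℤ-rawRing (fromCommutativeRing R) ℤ⟶R ⟪⟫-dec public

module Exponents where
  open ≡.≡-Reasoning

  -- triExp j = j(j-1), the exponent of t^{j(j-1)/2} as a power of q
  triExp : ℕ → ℕ
  triExp zero    = 0
  triExp (suc j) = 2 *ℕ j ℕ.+ triExp j

  triExp+j : ∀ j → triExp j ℕ.+ j ≡.≡ j *ℕ j
  triExp+j zero    = ≡.refl
  triExp+j (suc j) = begin
    (2 *ℕ j ℕ.+ triExp j) ℕ.+ suc j  ≡⟨ regroup j (triExp j) ⟩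
    suc (2 *ℕ j ℕ.+ (triExp j ℕ.+ j)) ≡⟨ ≡.cong (λ x → suc (2 *ℕ j ℕ.+ x)) (triExp+j j) ⟩
    suc (2 *ℕ j ℕ.+ j *ℕ j)           ≡⟨ square j ⟩
    suc j *ℕ suc j                     ∎
    where
    regroup : ∀ j x → (2 *ℕ j ℕ.+ x) ℕ.+ suc j ≡.≡ suc (2 *ℕ j ℕ.+ (x ℕ.+ j))
    regroup = solve-∀
    square : ∀ j → suc (2 *ℕ j ℕ.+ j *ℕ j) ≡.≡ suc j *ℕ suc j
    square = solve-∀

  top-exponent : ∀ g j b → suc g ≡.≡ j ℕ.+ b →
                 j *ℕ suc (2 *ℕ g) ℕ.+ b *ℕ b ≡.≡ suc g *ℕ suc g ℕ.+ triExp j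
  top-exponent g j b h≡j+b = ℕP.+-cancelʳ-≡ j _ _ (begin
    j *ℕ suc (2 *ℕ g) ℕ.+ b *ℕ b ℕ.+ j    ≡⟨ expand g j b ⟩
    j *ℕ (2 *ℕ suc g) ℕ.+ b *ℕ b          ≡⟨ ≡.cong (λ h → j *ℕ (2 *ℕ h) ℕ.+ b *ℕ b) h≡j+b ⟩
    j *ℕ (2 *ℕ (j ℕ.+ b)) ℕ.+ b *ℕ b      ≡⟨ complete-square j b ⟩
    (j ℕ.+ b) *ℕ (j ℕ.+ b) ℕ.+ j *ℕ j
      ≡⟨ ≡.cong₂ (λ h x → h *ℕ h ℕ.+ x) (≡.sym h≡j+b) (≡.sym (triExp+j j)) ⟩
    suc g *ℕ suc g ℕ.+ (triExp j ℕ.+ j)   ≡⟨ ℕP.+-assoc (suc g *ℕ suc g) (triExp j) j ⟨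
    suc g *ℕ suc g ℕ.+ triExp j ℕ.+ j     ∎)
    where
    expand : ∀ g j b → j *ℕ suc (2 *ℕ g) ℕ.+ b *ℕ b ℕ.+ j ≡.≡ j *ℕ (2 *ℕ suc g) ℕ.+ b *ℕ b
    expand = solve-∀
    complete-square : ∀ j b →
      j *ℕ (2 *ℕ (j ℕ.+ b)) ℕ.+ b *ℕ b ≡.≡ (j ℕ.+ b) *ℕ (j ℕ.+ b) ℕ.+ j *ℕ j
    complete-square = solve-∀

module Development {c ℓ : Level} (R : CommutativeRing c ℓ) where
  open CommutativeRing R hiding (zero)
  open IntegerSolver R using (solve; _:=_; _:+_; _:*_; _:-_; :-_; con)
  open import Relation.Binary.Reasoning.Setoid setoid

  ı ο : ∀ {n} → IntegerSolver.Polynomial R n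
  ı = con (+ 1)
  ο = con (+ 0)

  infixr 8 _^_
  _^_ : Carrier → ℕ → Carrier
  x ^ n = pow R x n

  ^-≡ : ∀ x {m n} → m ≡.≡ n → x ^ m ≈ x ^ n
  ^-≡ x m≡n = reflexive (≡.cong (x ^_) m≡n)

  ^-+ : ∀ x m n → x ^ (m ℕ.+ n) ≈ x ^ m * x ^ n
  ^-+ x zero    n = sym (*-identityˡ _)
  ^-+ x (suc m) n = trans (*-congˡ (^-+ x m n)) (sym (*-assoc x _ _))

  ^-square : ∀ x n → (x * x) ^ n ≈ x ^ (2 *ℕ n)
  ^-square x zero    = refl
  ^-square x (suc n) = begin
    (x * x) * (x * x) ^ n    ≈⟨ *-congˡ (^-square x n) ⟩
    (x * x) * x ^ (2 *ℕ n)   ≈⟨ *-assoc x x _ ⟩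
    x ^ suc (suc (2 *ℕ n))   ≈⟨ ^-≡ x (≡.cong suc (+-suc n (n ℕ.+ 0))) ⟨
    x ^ (2 *ℕ suc n)         ∎

  Σ⟨_⟩ : ℕ → (ℕ → Carrier) → Carrier
  Σ⟨ zero ⟩  f = f 0
  Σ⟨ suc n ⟩ f = f 0 + Σ⟨ n ⟩ (λ j → f (suc j))

  Σ-cong : ∀ n {f g : ℕ → Carrier} → (∀ j → f j ≈ g j) → Σ⟨ n ⟩ f ≈ Σ⟨ n ⟩ g
  Σ-cong zero    f≈g = f≈g 0
  Σ-cong (suc n) f≈g = +-cong (f≈g 0) (Σ-cong n (λ j → f≈g (suc j)))

  Σ-distribˡ : ∀ n a (f : ℕ → Carrier) → Σ⟨ n ⟩ (λ j → a * f j) ≈ a * Σ⟨ n ⟩ f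
  Σ-distribˡ zero    a f = refl
  Σ-distribˡ (suc n) a f =
    trans (+-congˡ (Σ-distribˡ n a (λ j → f (suc j)))) (sym (distribˡ a _ _))

  Σ-telescope : ∀ n (W : ℕ → Carrier) → Σ⟨ n ⟩ (λ j → W (suc j) - W j) ≈ W (suc n) - W 0
  Σ-telescope zero    W = refl
  Σ-telescope (suc n) W = begin
    (W 1 - W 0) + Σ⟨ n ⟩ (λ j → W (suc (suc j)) - W (suc j))
      ≈⟨ +-congˡ (Σ-telescope n (λ j → W (suc j))) ⟩
    (W 1 - W 0) + (W (suc (suc n)) - W 1)
      ≈⟨ solve 3 (λ a b c → (a :- b) :+ (c :- a) := c :- b) refl (W 1) (W 0) (W (suc (suc n))) ⟩
    W (suc (suc n)) - W 0 ∎

  sgn : ℕ → Carrier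
  sgn zero    = 1#
  sgn (suc m) = - sgn m

  -- A sequence ℕ → Carrier is read as the coefficient sequence of a power
  -- series in z.  prefix F n = [F n, …, F 0], so that  conv X 0 (prefix F n)
  -- (conv from Defs) is the coefficient [z^n] (X · F).
  prefix : (ℕ → Carrier) → ℕ → List Carrier
  prefix F zero    = F 0 ∷ []
  prefix F (suc n) = F (suc n) ∷ prefix F n

  mulCoeff : (ℕ → Carrier) → (ℕ → Carrier) → ℕ → Carrier
  mulCoeff X F n = conv R X 0 (prefix F n)

  conv-as-Σ : ∀ X F i n → conv R X i (prefix F n) ≈ Σ⟨ n ⟩ (λ j → X (i ℕ.+ j) * F (n ℕ.∸ j))
  conv-as-Σ X F i zero    =
    trans (+-identityʳ _) (*-congʳ (reflexive (≡.cong X (≡.sym (ℕP.+-identityʳ i)))))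
  conv-as-Σ X F i (suc n) = +-cong (*-congʳ (reflexive (≡.cong X (≡.sym (ℕP.+-identityʳ i)))))
    (trans (conv-as-Σ X F (suc i) n) (Σ-cong n (λ j → *-congʳ (reflexive (≡.cong X (≡.sym (+-suc i j)))))))

  conv-linear : ∀ (A B D : ℕ → Carrier) c a i xs →
    conv R (λ m → A m - c * B m - a * D m) i xs ≈ conv R A i xs - c * conv R B i xs - a * conv R D i xs
  conv-linear A B D c a i [] = solve 2 (λ c a → ο := ο :- c :* ο :- a :* ο) refl c a
  conv-linear A B D c a i (x ∷ xs) = begin
    (A i - c * B i - a * D i) * x + conv R (λ m → A m - c * B m - a * D m) (suc i) xs
      ≈⟨ +-congˡ (conv-linear A B D c a (suc i) xs) ⟩
    (A i - c * B i - a * D i) * x + (ΣA - c * ΣB - a * ΣD)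
      ≈⟨ solve 9 (λ Ai Bi Di c a x ΣA ΣB ΣD →
                       (Ai :- c :* Bi :- a :* Di) :* x :+ (ΣA :- c :* ΣB :- a :* ΣD)
                    := (Ai :* x :+ ΣA) :- c :* (Bi :* x :+ ΣB) :- a :* (Di :* x :+ ΣD))
                 refl (A i) (B i) (D i) c a x ΣA ΣB ΣD ⟩
    (A i * x + ΣA) - c * (B i * x + ΣB) - a * (D i * x + ΣD) ∎
    where
    ΣA = conv R A (suc i) xs
    ΣB = conv R B (suc i) xs
    ΣD = conv R D (suc i) xs

  conv-shift : ∀ X i xs → conv R (shiftZ R X) (suc i) xs ≈ conv R X i xs
  conv-shift X i []       = refl
  conv-shift X i (x ∷ xs) = +-congˡ (conv-shift X (suc i) xs)

  shift-agrees : ∀ X Y F N → (∀ n → n < N → mulCoeff X F n ≈ Y n) →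
                 ∀ n → n < suc N → mulCoeff (shiftZ R X) F n ≈ shiftZ R Y n
  shift-agrees X Y F N agree zero    _         = trans (+-identityʳ _) (zeroˡ _)
  shift-agrees X Y F N agree (suc n) (s≤s n<N) =
    trans (trans (+-cong (zeroˡ _) (conv-shift X 0 (prefix F n))) (+-identityˡ _)) (agree n n<N)

  shiftZ-cong : ∀ {X Y} → (∀ m → X m ≈ Y m) → ∀ m → shiftZ R X m ≈ shiftZ R Y m
  shiftZ-cong X≈Y zero    = refl
  shiftZ-cong X≈Y (suc m) = X≈Y m

  step-cong : ∀ q h {X₁ X₀ Y₁ Y₀} → (∀ m → X₁ m ≈ Y₁ m) → (∀ m → X₀ m ≈ Y₀ m) →
              ∀ m → step R q h X₁ X₀ m ≈ step R q h Y₁ Y₀ m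
  step-cong q h X₁≈Y₁ X₀≈Y₀ m = +-cong (+-cong (X₁≈Y₁ m) (-‿cong (*-congˡ (shiftZ-cong X₁≈Y₁ m))))
    (-‿cong (*-congˡ (shiftZ-cong (shiftZ-cong X₀≈Y₀) m)))

  module Quotient (P Q F : ℕ → Carrier) (N : ℕ) (Q₀≈1 : Q 0 ≈ 1#)
                  (agree : ∀ m → m ≤ N → mulCoeff Q F m ≈ P m) where

    conv-cong : ∀ i {xs ys} → Pointwise _≈_ xs ys → conv R Q i xs ≈ conv R Q i ys
    conv-cong i []             = refl
    conv-cong i (x≈y ∷ xs≈ys) = +-cong (*-congˡ x≈y) (conv-cong (suc i) xs≈ys)

    quotCoeffs≈prefix : ∀ n → n ≤ N → Pointwise _≈_ (quotCoeffs R P Q n) (prefix F n)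
    quotCoeffs≈prefix zero    0≤N   = first ∷ []
      where
      first : P 0 ≈ F 0
      first = begin
        P 0              ≈⟨ agree 0 0≤N ⟨
        Q 0 * F 0 + 0#   ≈⟨ +-identityʳ _ ⟩
        Q 0 * F 0        ≈⟨ *-congʳ Q₀≈1 ⟩
        1# * F 0         ≈⟨ *-identityˡ _ ⟩
        F 0              ∎
    quotCoeffs≈prefix (suc n) n<N = next ∷ earlier
      where
      earlier = quotCoeffs≈prefix n (ℕP.<⇒≤ n<N)
      rest = conv R Q 1 (prefix F n)
      next : P (suc n) - conv R Q 1 (quotCoeffs R P Q n) ≈ F (suc n)
      next = begin
        P (suc n) - conv R Q 1 (quotCoeffs R P Q n)  ≈⟨ +-congˡ (-‿cong (conv-cong 1 earlier)) ⟩
        P (suc n) - rest                              ≈⟨ +-congʳ (agree (suc n) n<N) ⟨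
        (Q 0 * F (suc n) + rest) - rest               ≈⟨ +-congʳ (+-congʳ (*-congʳ Q₀≈1)) ⟩
        (1# * F (suc n) + rest) - rest
          ≈⟨ solve 2 (λ f r → (ı :* f :+ r) :- r := f) refl (F (suc n)) rest ⟩
        F (suc n)                                     ∎

    series≈ : ∀ n → n ≤ N → seriesCoeff R P Q n ≈ F n
    series≈ zero    0≤N with quotCoeffs≈prefix zero 0≤N
    ... | first ∷ _ = first
    series≈ (suc n) n<N with quotCoeffs≈prefix (suc n) n<N
    ... | next ∷ _ = next

  module GaussianBinomials (t : Carrier) where

    -- gauss a b = [a+b choose a]_t, generated by the t-Pascal rule.
    gauss : ℕ → ℕ → Carrier
    gauss zero    b       = 1#
    gauss (suc a) zero    = 1#
    gauss (suc a) (suc b) = gauss a (suc b) + t ^ suc a * gauss (suc a) b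

    gauss-zeroʳ : ∀ a → gauss a 0 ≈ 1#
    gauss-zeroʳ zero    = refl
    gauss-zeroʳ (suc a) = refl

    -- (1 - t^{b+1}) [a+b+1, a] = (1 - t^{a+1}) [a+b+1, a+1]; this relates the
    -- t-Pascal rule to its mirror image, and is proved by induction on a and b.
    gauss-rotate : ∀ a b → (1# - t ^ suc b) * gauss a (suc b) ≈ (1# - t ^ suc a) * gauss (suc a) b
    gauss-rotate zero zero = refl
    gauss-rotate zero (suc b) = begin
      (1# - t * t ^ suc b) * 1#
        ≈⟨ solve 2 (λ t s → (ı :- t :* s) :* ı
                         := (ı :- t :* ı) :+ (t :* ı) :* ((ı :- s) :* ı)) refl t (t ^ suc b) ⟩
      (1# - t * 1#) + (t * 1#) * ((1# - t ^ suc b) * 1#)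
        ≈⟨ +-congˡ (*-congˡ (gauss-rotate zero b)) ⟩
      (1# - t * 1#) + (t * 1#) * ((1# - t * 1#) * gauss 1 b)
        ≈⟨ solve 2 (λ t X → (ı :- t :* ı) :+ (t :* ı) :* ((ı :- t :* ı) :* X)
                         := (ı :- t :* ı) :* (ı :+ (t :* ı) :* X)) refl t (gauss 1 b) ⟩
      (1# - t * 1#) * (1# + (t * 1#) * gauss 1 b) ∎
    gauss-rotate (suc a) zero = begin
      (1# - t * 1#) * (gauss a 1 + r * 1#)
        ≈⟨ solve 3 (λ t r Z → (ı :- t :* ı) :* (Z :+ r :* ı)
                           := (ı :- t :* ı) :* Z :+ (ı :- t :* ı) :* r) refl t r (gauss a 1) ⟩
      (1# - t * 1#) * gauss a 1 + (1# - t * 1#) * r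
        ≈⟨ +-congʳ (trans (gauss-rotate a zero) (*-congˡ (gauss-zeroʳ (suc a)))) ⟩
      (1# - r) * 1# + (1# - t * 1#) * r
        ≈⟨ solve 2 (λ t r → (ı :- r) :* ı :+ (ı :- t :* ı) :* r := (ı :- t :* r) :* ı) refl t r ⟩
      (1# - t * r) * 1# ∎
      where r = t ^ suc a
    gauss-rotate (suc a) (suc b) = begin
      (1# - t * s) * (gauss a (suc (suc b)) + r * X)
        ≈⟨ solve 5 (λ t s r X Z → (ı :- t :* s) :* (Z :+ r :* X)
                               := (ı :- t :* s) :* Z :+ (ı :- t :* s) :* r :* X)
                 refl t s r X (gauss a (suc (suc b))) ⟩
      (1# - t * s) * gauss a (suc (suc b)) + (1# - t * s) * r * X
        ≈⟨ +-congʳ (gauss-rotate a (suc b)) ⟩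
      (1# - r) * X + (1# - t * s) * r * X
        ≈⟨ solve 4 (λ t s r X → (ı :- r) :* X :+ (ı :- t :* s) :* r :* X
                             := (ı :- t :* r) :* X :+ t :* r :* ((ı :- s) :* X)) refl t s r X ⟩
      (1# - t * r) * X + t * r * ((1# - s) * X)
        ≈⟨ +-congˡ (*-congˡ (gauss-rotate (suc a) b)) ⟩
      (1# - t * r) * X + t * r * ((1# - t * r) * Y)
        ≈⟨ solve 4 (λ t r X Y → (ı :- t :* r) :* X :+ t :* r :* ((ı :- t :* r) :* Y)
                             := (ı :- t :* r) :* (X :+ (t :* r) :* Y)) refl t r X Y ⟩
      (1# - t * r) * (X + (t * r) * Y) ∎
      where
      r = t ^ suc a
      s = t ^ suc b
      X = gauss (suc a) (suc b)
      Y = gauss (suc (suc a)) b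

    gauss-pascal′ : ∀ a b → gauss (suc a) (suc b) ≈ t ^ suc b * gauss a (suc b) + gauss (suc a) b
    gauss-pascal′ a b = begin
      Z + r * W
        ≈⟨ solve 4 (λ r s Z W → Z :+ r :* W
                             := s :* Z :+ W :+ ((ı :- s) :* Z :- (ı :- r) :* W)) refl r s Z W ⟩
      s * Z + W + ((1# - s) * Z - (1# - r) * W)
        ≈⟨ +-congˡ (+-congʳ (gauss-rotate a b)) ⟩
      s * Z + W + ((1# - r) * W - (1# - r) * W)
        ≈⟨ solve 4 (λ r s Z W → s :* Z :+ W :+ ((ı :- r) :* W :- (ı :- r) :* W)
                             := s :* Z :+ W) refl r s Z W ⟩
      s * Z + W ∎
      where
      r = t ^ suc a
      s = t ^ suc b
      Z = gauss a (suc b)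
      W = gauss (suc a) b

    gauss-absorbʳ : ∀ a b → (1# - t ^ suc b) * gauss a (suc b) ≈ (1# - t ^ suc (a ℕ.+ b)) * gauss a b
    gauss-absorbʳ zero    b = refl
    gauss-absorbʳ (suc a) b = begin
      (1# - s) * gauss (suc a) (suc b)       ≈⟨ *-congˡ (gauss-pascal′ a b) ⟩
      (1# - s) * (s * Z + W)
        ≈⟨ solve 3 (λ s Z W → (ı :- s) :* (s :* Z :+ W)
                           := s :* ((ı :- s) :* Z) :+ (ı :- s) :* W) refl s Z W ⟩
      s * ((1# - s) * Z) + (1# - s) * W     ≈⟨ +-congʳ (*-congˡ (gauss-rotate a b)) ⟩
      s * ((1# - r) * W) + (1# - s) * W
        ≈⟨ solve 3 (λ s r W → s :* ((ı :- r) :* W) :+ (ı :- s) :* W := (ı :- s :* r) :* W) refl s r W ⟩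
      (1# - s * r) * W                       ≈⟨ *-congʳ (+-congˡ (-‿cong sr≈u)) ⟩
      (1# - t ^ suc (suc a ℕ.+ b)) * W       ∎
      where
      r = t ^ suc a
      s = t ^ suc b
      Z = gauss a (suc b)
      W = gauss (suc a) b
      sr≈u : s * r ≈ t ^ suc (suc a ℕ.+ b)
      sr≈u = trans (sym (^-+ t (suc b) (suc a))) (^-≡ t (exponent a b))
        where
        exponent : ∀ a b → suc b ℕ.+ suc a ≡.≡ suc (suc a ℕ.+ b)
        exponent = solve-∀

    gauss-absorbˡ : ∀ a b → (1# - t ^ suc a) * gauss (suc a) b ≈ (1# - t ^ suc (a ℕ.+ b)) * gauss a b
    gauss-absorbˡ a b = trans (sym (gauss-rotate a b)) (gauss-absorbʳ a b)

    -- The three-term identity behind the closed form of Q_h, with m = k+2,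
    -- h = m+b+1 and u = t^{h-1}:
    --   t^m [h, m] = [h-1, m] + (t u + u - 1) [h-1, m-1] - t^{b+1} (u - 1) [h-2, m-2].
    gauss-three-term : ∀ k b → let u = t ^ suc (k ℕ.+ suc b) in
      t ^ suc (suc k) * gauss (suc (suc k)) (suc b)
        ≈ gauss (suc (suc k)) b + (t * u + u - 1#) * gauss (suc k) (suc b)
          - t ^ suc b * (u - 1#) * gauss k (suc b)
    gauss-three-term k b = begin
      (t * r) * gauss (suc (suc k)) (suc b)     ≈⟨ *-congˡ (gauss-pascal′ (suc k) b) ⟩
      (t * r) * (s * X + Y)
        ≈⟨ solve 5 (λ t r s X Y → (t :* r) :* (s :* X :+ Y)
                               := t :* (r :* s) :* X :+ Y :- (ı :- t :* r) :* Y) refl t r s X Y ⟩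
      t * (r * s) * X + Y - (1# - t * r) * Y
        ≈⟨ +-cong (+-congʳ (*-congʳ (*-congˡ rs≈u))) (-‿cong absorbed) ⟩
      t * u * X + Y - (1# - u) * W
        ≈⟨ +-congˡ (-‿cong (*-congˡ W≈X-sZ)) ⟩
      t * u * X + Y - (1# - u) * (X - s * Z)
        ≈⟨ solve 6 (λ t u s X Y Z → t :* u :* X :+ Y :- (ı :- u) :* (X :- s :* Z)
                                 := Y :+ (t :* u :+ u :- ı) :* X :- s :* (u :- ı) :* Z) refl t u s X Y Z ⟩
      Y + (t * u + u - 1#) * X - s * (u - 1#) * Z ∎
      where
      r = t ^ suc k
      s = t ^ suc b
      u = t ^ suc (k ℕ.+ suc b)
      X = gauss (suc k) (suc b)
      Y = gauss (suc (suc k)) b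
      Z = gauss k (suc b)
      W = gauss (suc k) b
      rs≈u : r * s ≈ u
      rs≈u = sym (^-+ t (suc k) (suc b))
      absorbed : (1# - t * r) * Y ≈ (1# - u) * W
      absorbed = trans (gauss-absorbˡ (suc k) b)
                       (*-congʳ (+-congˡ (-‿cong (^-≡ t (≡.cong suc (≡.sym (+-suc k b)))))))
      W≈X-sZ : W ≈ X - s * Z
      W≈X-sZ = begin
        W                   ≈⟨ solve 2 (λ sZ W → W := (sZ :+ W) :- sZ) refl (s * Z) W ⟩
        (s * Z + W) - s * Z ≈⟨ +-congʳ (gauss-pascal′ k b) ⟨
        X - s * Z           ∎

    binom : ℕ → ℕ → Carrier
    binom n       zero    = 1#
    binom zero    (suc k) = 0#
    binom (suc n) (suc k) = binom n k + t ^ suc k * binom n (suc k)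

    binom-vanish : ∀ {n k} → n < k → binom n k ≈ 0#
    binom-vanish {zero}  {suc k} _          = refl
    binom-vanish {suc n} {suc k} (s≤s n<k) = begin
      binom n k + t ^ suc k * binom n (suc k)
        ≈⟨ +-cong (binom-vanish n<k) (*-congˡ (binom-vanish (ℕP.m<n⇒m<1+n n<k))) ⟩
      0# + t ^ suc k * 0#   ≈⟨ solve 1 (λ x → ο :+ x :* ο := ο) refl (t ^ suc k) ⟩
      0#                    ∎

    binom-diag : ∀ n → binom n n ≈ 1#
    binom-diag zero    = refl
    binom-diag (suc n) = begin
      binom n n + t ^ suc n * binom n (suc n)
        ≈⟨ +-cong (binom-diag n) (*-congˡ (binom-vanish (ℕP.n<1+n n))) ⟩
      1# + t ^ suc n * 0#
        ≈⟨ solve 1 (λ x → ı :+ x :* ο := ı) refl (t ^ suc n) ⟩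
      1# ∎

    binom-gauss : ∀ k b → binom (k ℕ.+ b) k ≈ gauss k b
    binom-gauss zero    b       = refl
    binom-gauss (suc k) zero    rewrite ℕP.+-identityʳ k = binom-diag (suc k)
    binom-gauss (suc k) (suc b) = +-cong (binom-gauss k (suc b))
      (*-congˡ (trans (reflexive (≡.cong (λ n → binom n (suc k)) (+-suc k b))) (binom-gauss (suc k) b)))

    binom-three-term : ∀ k b → let g = k ℕ.+ b in
      t ^ suc (suc k) * binom (suc (suc g)) (suc (suc k))
        ≈ binom (suc g) (suc (suc k)) + (t ^ suc (suc g) + t ^ suc g - 1#) * binom (suc g) (suc k)
          - t ^ b * (t ^ suc g - 1#) * binom g k
    binom-three-term k zero rewrite ℕP.+-identityʳ k = begin
      t ^ suc (suc k) * binom (suc (suc k)) (suc (suc k))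
        ≈⟨ *-congˡ (binom-diag (suc (suc k))) ⟩
      t * r * 1#
        ≈⟨ solve 2 (λ t r → t :* r :* ı
                         := ο :+ (t :* r :+ r :- ı) :* ı :- ı :* (r :- ı) :* ı) refl t r ⟩
      0# + (t * r + r - 1#) * 1# - 1# * (r - 1#) * 1#
        ≈⟨ +-cong (+-cong (sym (binom-vanish (ℕP.n<1+n (suc k)))) (*-congˡ (sym (binom-diag (suc k)))))
                  (-‿cong (*-congˡ (sym (binom-diag k)))) ⟩
      binom (suc k) (suc (suc k)) + (t * r + r - 1#) * binom (suc k) (suc k) - 1# * (r - 1#) * binom k k ∎
      where r = t ^ suc k
    binom-three-term k (suc b) = begin
      t ^ suc (suc k) * binom (suc (suc (k ℕ.+ suc b))) (suc (suc k))
        ≈⟨ *-congˡ (binom-gauss (suc (suc k)) (suc b)) ⟩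
      t ^ suc (suc k) * gauss (suc (suc k)) (suc b)
        ≈⟨ gauss-three-term k b ⟩
      gauss (suc (suc k)) b + (t * u + u - 1#) * gauss (suc k) (suc b) - t ^ suc b * (u - 1#) * gauss k (suc b)
        ≈⟨ +-cong (+-cong top (*-congˡ (sym (binom-gauss (suc k) (suc b)))))
                  (-‿cong (*-congˡ (sym (binom-gauss k (suc b))))) ⟩
      binom (suc (k ℕ.+ suc b)) (suc (suc k)) + (t * u + u - 1#) * binom (suc (k ℕ.+ suc b)) (suc k)
        - t ^ suc b * (u - 1#) * binom (k ℕ.+ suc b) k ∎
      where
      u = t ^ suc (k ℕ.+ suc b)
      top : gauss (suc (suc k)) b ≈ binom (suc (k ℕ.+ suc b)) (suc (suc k))
      top = sym (trans (reflexive (≡.cong (λ n → binom (suc n) (suc (suc k))) (+-suc k b)))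
                       (binom-gauss (suc (suc k)) b))

    binom-one-suc : ∀ n → binom (suc n) 1 ≈ binom n 1 + t ^ n
    binom-one-suc zero    = solve 1 (λ x → ı :+ x :* ο := ο :+ ı) refl (t ^ 1)
    binom-one-suc (suc n) = begin
      1# + t ^ 1 * binom (suc n) 1        ≈⟨ +-congˡ (*-congˡ (binom-one-suc n)) ⟩
      1# + t ^ 1 * (binom n 1 + t ^ n)
        ≈⟨ solve 3 (λ t B r → ı :+ (t :* ı) :* (B :+ r)
                           := (ı :+ (t :* ı) :* B) :+ t :* r) refl t (binom n 1) (t ^ n) ⟩
      (1# + t ^ 1 * binom n 1) + t * t ^ n  ∎

    binom-three-term-one : ∀ g →
      t * binom (suc (suc g)) 1 ≈ binom (suc g) 1 + t ^ suc (suc g) + t ^ suc g - 1#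
    binom-three-term-one g = begin
      t * binom (suc (suc g)) 1
        ≈⟨ solve 2 (λ t B → t :* B := (ı :+ (t :* ı) :* B) :- ı) refl t (binom (suc (suc g)) 1) ⟩
      binom (suc (suc (suc g))) 1 - 1#
        ≈⟨ +-congʳ (trans (binom-one-suc (suc (suc g))) (+-congʳ (binom-one-suc (suc g)))) ⟩
      (binom (suc g) 1 + t ^ suc g) + t ^ suc (suc g) - 1#
        ≈⟨ solve 3 (λ B x y → (B :+ x) :+ y :- ı
                           := B :+ y :+ x :- ı) refl (binom (suc g) 1) (t ^ suc g) (t ^ suc (suc g)) ⟩
      binom (suc g) 1 + t ^ suc (suc g) + t ^ suc g - 1# ∎

    -- tri j = t^{0+1+…+(j-1)} = t^{j(j-1)/2}
    tri : ℕ → Carrier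
    tri zero    = 1#
    tri (suc j) = t ^ j * tri j

    -- The t-binomial theorem at x = -1: for n ≥ 1,
    --   Σ_j (-1)^j t^{j(j-1)/2} [n, j] = 0.
    -- By the t-Pascal rule the summands are consecutive differences, so the sum telescopes.
    alternating-sum : ∀ g → Σ⟨ suc g ⟩ (λ j → sgn j * (tri j * binom (suc g) j)) ≈ 0#
    alternating-sum g = begin
      w 0 + Σ⟨ g ⟩ (λ j → w (suc j))            ≈⟨ +-congˡ (Σ-cong g difference) ⟩
      w 0 + Σ⟨ g ⟩ (λ j → V (suc j) - V j)      ≈⟨ +-congˡ (Σ-telescope g V) ⟩
      w 0 + (V (suc g) - V 0)                    ≈⟨ +-congˡ (+-congʳ V-top) ⟩
      1# * (1# * 1#) + (0# - 1# * ((1# * 1#) * 1#))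
        ≈⟨ solve 0 (ı :* (ı :* ı) :+ (ο :- ı :* ((ı :* ı) :* ı)) := ο) refl ⟩
      0# ∎
      where
      w : ℕ → Carrier
      w j = sgn j * (tri j * binom (suc g) j)
      V : ℕ → Carrier
      V j = sgn j * (tri (suc j) * binom g j)
      difference : ∀ j → w (suc j) ≈ V (suc j) - V j
      difference j = begin
        - sgn j * (tri (suc j) * (binom g j + t ^ suc j * binom g (suc j)))
          ≈⟨ solve 5 (λ s τ B r B′ → :- s :* (τ :* (B :+ r :* B′))
                                   := :- s :* ((r :* τ) :* B′) :- s :* (τ :* B)) refl
                     (sgn j) (tri (suc j)) (binom g j) (t ^ suc j) (binom g (suc j)) ⟩
        - sgn j * (tri (suc (suc j)) * binom g (suc j)) - sgn j * (tri (suc j) * binom g j) ∎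
      V-top : V (suc g) ≈ 0#
      V-top = trans (*-congˡ (trans (*-congˡ (binom-vanish (ℕP.n<1+n g))) (zeroʳ _))) (zeroʳ _)

  module Convergents (q : Carrier) where
    t : Carrier
    t = q * q

    open GaussianBinomials t
    open Exponents using (triExp; top-exponent)

    t^≈q^ : ∀ n → t ^ n ≈ q ^ (2 *ℕ n)
    t^≈q^ = ^-square q

    ^-split : ∀ {a} b n → a ≡.≡ b ℕ.+ 2 *ℕ n → q ^ a ≈ q ^ b * t ^ n
    ^-split b n a≡b+2n = trans (^-≡ q a≡b+2n) (trans (^-+ q b (2 *ℕ n)) (*-congˡ (sym (t^≈q^ n))))

    ^-merge : ∀ a b {c} → a ℕ.+ b ≡.≡ c → q ^ a * q ^ b ≈ q ^ c
    ^-merge a b a+b≡c = trans (sym (^-+ q a b)) (^-≡ q a+b≡c)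

    q^[2g+2]≈t^[g+1] : ∀ g → q ^ (2 *ℕ g ℕ.+ 2) ≈ t ^ suc g
    q^[2g+2]≈t^[g+1] g = sym (trans (t^≈q^ (suc g)) (^-≡ q (exponent g)))
      where
      exponent : ∀ g → 2 *ℕ suc g ≡.≡ 2 *ℕ g ℕ.+ 2
      exponent = solve-∀

    q^[2g+4]≈t^[g+2] : ∀ g → q ^ (2 *ℕ g ℕ.+ 4) ≈ t ^ suc (suc g)
    q^[2g+4]≈t^[g+2] g = sym (trans (t^≈q^ (suc (suc g))) (^-≡ q (exponent g)))
      where
      exponent : ∀ g → 2 *ℕ suc (suc g) ≡.≡ 2 *ℕ g ℕ.+ 4
      exponent = solve-∀

    -- the exponent 2h - 1 (and 0 for h = 0)
    odd : ℕ → ℕ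
    odd zero    = 0
    odd (suc g) = suc (2 *ℕ g)

    K : ℕ → ℕ → Carrier
    K h m = sgn m * (q ^ (m *ℕ odd h) * binom h m)

    K-vanish : ∀ {h m} → h < m → K h m ≈ 0#
    K-vanish h<m = trans (*-congˡ (trans (*-congˡ (binom-vanish h<m)) (zeroʳ _))) (zeroʳ _)

    c≈ : ∀ g → cc R q (suc (suc g)) ≈ q ^ (2 *ℕ g ℕ.+ 1) * (t ^ suc (suc g) + t ^ suc g - 1#)
    c≈ g = *-congˡ (+-congʳ (+-cong (q^[2g+4]≈t^[g+2] g) (q^[2g+2]≈t^[g+1] g)))

    α≈ : ∀ g → αα R q (suc (suc g)) ≈ q ^ (6 *ℕ g ℕ.+ 2) * (t ^ suc g - 1#)
    α≈ g = *-congˡ (+-congʳ (q^[2g+2]≈t^[g+1] g))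

    Steps : ℕ → ℕ → Set ℓ
    Steps g m = K (suc (suc g)) m ≈ step R q (suc (suc g)) (K (suc g)) (K g) m

    -- the q-power in front of α_h K_{h-2, m-2}, for m = k+2 and h = g+2 = m+b:
    -- q^{6g+2} q^{(m-2)(2g-1)} = q^{m(2h-3)} t^{h-m}
    α-exponent : ∀ k b → q ^ (6 *ℕ (k ℕ.+ b) ℕ.+ 2) * q ^ (k *ℕ odd (k ℕ.+ b))
                         ≈ q ^ (suc (suc k) *ℕ odd (suc (k ℕ.+ b))) * t ^ b
    α-exponent zero    b =
      trans (sym (^-+ q (6 *ℕ b ℕ.+ 2) 0)) (^-split (2 *ℕ suc (2 *ℕ b)) b (exponent b))
      where
      exponent : ∀ b → 6 *ℕ b ℕ.+ 2 ℕ.+ 0 ≡.≡ 2 *ℕ suc (2 *ℕ b) ℕ.+ 2 *ℕ b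
      exponent = solve-∀
    α-exponent (suc k) b = trans (sym (^-+ q (6 *ℕ (suc k ℕ.+ b) ℕ.+ 2) (suc k *ℕ odd (suc k ℕ.+ b))))
                             (^-split (suc (suc (suc k)) *ℕ odd (suc (suc k ℕ.+ b))) b (exponent k b))
      where
      exponent : ∀ k b → 6 *ℕ (suc k ℕ.+ b) ℕ.+ 2 ℕ.+ suc k *ℕ suc (2 *ℕ (k ℕ.+ b))
                         ≡.≡ suc (suc (suc k)) *ℕ suc (2 *ℕ (suc k ℕ.+ b)) ℕ.+ 2 *ℕ b
      exponent = solve-∀

    -- Distributing a common factor s Y over the three terms of the recurrence, where
    -- the factors of the second and third term are split as Y = a e and Y T = a′ e′.
    redistribute : ∀ s Y B₁′ C B₁ T A B₀ a e a′ e′ → a * e ≈ Y → a′ * e′ ≈ Y * T →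
      - - s * (Y * (B₁′ + C * B₁ - T * A * B₀))
        ≈ - - s * (Y * B₁′) - (a * C) * (- s * (e * B₁)) - (a′ * A) * (s * (e′ * B₀))
    redistribute s Y B₁′ C B₁ T A B₀ a e a′ e′ Y≈ae YT≈a′e′ = begin
      - - s * (Y * (B₁′ + C * B₁ - T * A * B₀))
        ≈⟨ solve 8 (λ s Y B₁′ C B₁ T A B₀ →
               :- :- s :* (Y :* (B₁′ :+ C :* B₁ :- T :* A :* B₀))
            := :- :- s :* (Y :* B₁′) :- (C :* (:- s :* B₁)) :* Y :- (A :* (s :* B₀)) :* (Y :* T))
           refl s Y B₁′ C B₁ T A B₀ ⟩
      - - s * (Y * B₁′) - (C * (- s * B₁)) * Y - (A * (s * B₀)) * (Y * T)
        ≈⟨ +-cong (+-congˡ (-‿cong (*-congˡ (sym Y≈ae)))) (-‿cong (*-congˡ (sym YT≈a′e′))) ⟩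
      - - s * (Y * B₁′) - (C * (- s * B₁)) * (a * e) - (A * (s * B₀)) * (a′ * e′)
        ≈⟨ solve 11 (λ s Y B₁′ C B₁ A B₀ a e a′ e′ →
               :- :- s :* (Y :* B₁′) :- (C :* (:- s :* B₁)) :* (a :* e) :- (A :* (s :* B₀)) :* (a′ :* e′)
            := :- :- s :* (Y :* B₁′) :- (a :* C) :* (:- s :* (e :* B₁)) :- (a′ :* A) :* (s :* (e′ :* B₀)))
           refl s Y B₁′ C B₁ A B₀ a e a′ e′ ⟩
      - - s * (Y * B₁′) - (a * C) * (- s * (e * B₁)) - (a′ * A) * (s * (e′ * B₀)) ∎

    -- In degree m = k+2 ≤ h (g = k+b) the recurrence is the three-term identity for
    -- binomials multiplied by (-1)^m q^{m(2h-3)}; the powers of q are matched first.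
    K-step-interior : ∀ k b → Steps (k ℕ.+ b) (suc (suc k))
    K-step-interior k b = begin
      - - s * (q ^ (suc (suc k) *ℕ odd (suc (suc g))) * binom (suc (suc g)) (suc (suc k)))
        ≈⟨ *-congˡ (trans (*-congʳ (^-split (suc (suc k) *ℕ odd (suc g)) (suc (suc k)) (exponent₁ k g)))
                          (*-assoc _ _ _)) ⟩
      - - s * (Y * (t ^ suc (suc k) * binom (suc (suc g)) (suc (suc k))))
        ≈⟨ *-congˡ (*-congˡ (binom-three-term k b)) ⟩
      - - s * (Y * (B₁′ + C * B₁ - t ^ b * A * B₀))
        ≈⟨ redistribute s Y B₁′ C B₁ (t ^ b) A B₀ (q ^ (2 *ℕ g ℕ.+ 1)) e (q ^ (6 *ℕ g ℕ.+ 2)) e′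
                        (^-merge (2 *ℕ g ℕ.+ 1) (suc k *ℕ odd (suc g)) (exponent₂ k g)) (α-exponent k b) ⟩
      - - s * (Y * B₁′) - (q ^ (2 *ℕ g ℕ.+ 1) * C) * (- s * (e * B₁))
        - (q ^ (6 *ℕ g ℕ.+ 2) * A) * (s * (e′ * B₀))
        ≈⟨ +-cong (+-congˡ (-‿cong (*-congʳ (c≈ g)))) (-‿cong (*-congʳ (α≈ g))) ⟨
      K (suc g) (suc (suc k)) - cc R q (suc (suc g)) * K (suc g) (suc k) - αα R q (suc (suc g)) * K g k ∎
      where
      g = k ℕ.+ b
      s = sgn k
      Y = q ^ (suc (suc k) *ℕ odd (suc g))
      e = q ^ (suc k *ℕ odd (suc g))
      e′ = q ^ (k *ℕ odd g)
      C = t ^ suc (suc g) + t ^ suc g - 1#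
      A = t ^ suc g - 1#
      B₁′ = binom (suc g) (suc (suc k))
      B₁ = binom (suc g) (suc k)
      B₀ = binom g k
      exponent₁ : ∀ k g →
        suc (suc k) *ℕ suc (2 *ℕ suc g) ≡.≡ suc (suc k) *ℕ suc (2 *ℕ g) ℕ.+ 2 *ℕ suc (suc k)
      exponent₁ = solve-∀
      exponent₂ : ∀ k g → (2 *ℕ g ℕ.+ 1) ℕ.+ suc k *ℕ suc (2 *ℕ g) ≡.≡ suc (suc k) *ℕ suc (2 *ℕ g)
      exponent₂ = solve-∀

    -- the recurrence in every degree: degree 0 is trivial, degree 1 is the m = 1
    -- three-term identity, and above h all terms vanish
    K-step : ∀ g m → Steps g m
    K-step g zero = solve 2 (λ c a → ı :* (ı :* ı) := ı :* (ı :* ı) :- c :* ο :- a :* ο) refl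
                      (cc R q (suc (suc g))) (αα R q (suc (suc g)))
    K-step g (suc zero) = begin
      - 1# * (q ^ (1 *ℕ odd (suc (suc g))) * binom (suc (suc g)) 1)
        ≈⟨ *-congˡ (*-congʳ (^-split (2 *ℕ g ℕ.+ 1) 1 (exponent₁ g))) ⟩
      - 1# * ((a * t ^ 1) * binom (suc (suc g)) 1)
        ≈⟨ solve 3 (λ a t B → :- ı :* ((a :* (t :* ı)) :* B)
                           := (:- ı :* a) :* (t :* B)) refl a t (binom (suc (suc g)) 1) ⟩
      (- 1# * a) * (t * binom (suc (suc g)) 1)
        ≈⟨ *-congˡ (binom-three-term-one g) ⟩
      (- 1# * a) * (B₁ + t ^ suc (suc g) + t ^ suc g - 1#)
        ≈⟨ solve 5 (λ a B₁ x y α → (:- ı :* a) :* (B₁ :+ x :+ y :- ı)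
                             := :- ı :* (a :* B₁) :- (a :* (x :+ y :- ı)) :* (ı :* (ı :* ı)) :- α :* ο)
                 refl a B₁ (t ^ suc (suc g)) (t ^ suc g) (αα R q (suc (suc g))) ⟩
      - 1# * (a * B₁) - (a * (t ^ suc (suc g) + t ^ suc g - 1#)) * (1# * (1# * 1#)) - αα R q (suc (suc g)) * 0#
        ≈⟨ +-congʳ (+-cong (*-congˡ (*-congʳ (^-≡ q (exponent₂ g)))) (-‿cong (*-congʳ (c≈ g)))) ⟨
      K (suc g) 1 - cc R q (suc (suc g)) * K (suc g) 0 - αα R q (suc (suc g)) * 0# ∎
      where
      a = q ^ (2 *ℕ g ℕ.+ 1)
      B₁ = binom (suc g) 1
      exponent₁ : ∀ g → 1 *ℕ suc (2 *ℕ suc g) ≡.≡ 2 *ℕ g ℕ.+ 1 ℕ.+ 2 *ℕ 1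
      exponent₁ = solve-∀
      exponent₂ : ∀ g → 1 *ℕ suc (2 *ℕ g) ≡.≡ 2 *ℕ g ℕ.+ 1
      exponent₂ = solve-∀
    K-step g (suc (suc k)) with k ℕ.≤? g
    ... | yes k≤g = ≡.subst (λ g → Steps g (suc (suc k))) (ℕP.m+[n∸m]≡n k≤g) (K-step-interior k (g ℕ.∸ k))
    ... | no k≰g = begin
      K (suc (suc g)) (suc (suc k))  ≈⟨ K-vanish (s≤s (s≤s g<k)) ⟩
      0#
        ≈⟨ solve 2 (λ c a → ο := ο :- c :* ο :- a :* ο) refl (cc R q (suc (suc g))) (αα R q (suc (suc g))) ⟩
      0# - cc R q (suc (suc g)) * 0# - αα R q (suc (suc g)) * 0#
        ≈⟨ +-cong (+-cong (K-vanish (ℕP.m<n⇒m<1+n (s≤s g<k))) (-‿cong (*-congˡ (K-vanish (s≤s g<k)))))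
                  (-‿cong (*-congˡ (K-vanish g<k))) ⟨
      K (suc g) (suc (suc k)) - cc R q (suc (suc g)) * K (suc g) (suc k) - αα R q (suc (suc g)) * K g k ∎
      where
      g<k : g < k
      g<k = ℕP.≰⇒> k≰g

    Q-closed : ∀ h m → Qpoly R q h m ≈ K h m
    Q-closed zero          zero          = solve 0 (ı := ı :* (ı :* ı)) refl
    Q-closed zero          (suc m)       = sym (K-vanish {m = suc m} (s≤s z≤n))
    Q-closed (suc zero)    zero          = solve 0 (ı := ı :* (ı :* ı)) refl
    Q-closed (suc zero)    (suc zero)    =
      solve 2 (λ q t → :- q := :- ı :* ((q :* ı) :* (ı :+ (t :* ı) :* ο))) refl q t
    Q-closed (suc zero)    (suc (suc m)) = sym (K-vanish {m = suc (suc m)} (s≤s (s≤s z≤n)))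
    Q-closed (suc (suc g)) m             =
      trans (step-cong q (suc (suc g)) (Q-closed (suc g)) (Q-closed g) m) (sym (K-step g m))

    Q-constant : ∀ h → Qpoly R q h 0 ≈ 1#
    Q-constant h = trans (Q-closed h 0) (solve 0 (ı :* (ı :* ı) := ı) refl)

    P-degree : ∀ h n → h ≤ n → Ppoly R q h n ≈ 0#
    P-degree zero          n             _                 = refl
    P-degree (suc zero)    (suc n)       _                 = refl
    P-degree (suc (suc g)) (suc (suc n)) (s≤s (s≤s g≤n)) = begin
      Ppoly R q (suc g) (suc (suc n)) - cₕ * Ppoly R q (suc g) (suc n) - αₕ * Ppoly R q g n
        ≈⟨ +-cong (+-cong (P-degree (suc g) (suc (suc n)) (ℕP.m≤n⇒m≤1+n (s≤s g≤n)))
                          (-‿cong (*-congˡ (P-degree (suc g) (suc n) (s≤s g≤n)))))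
                  (-‿cong (*-congˡ (P-degree g n g≤n))) ⟩
      0# - cₕ * 0# - αₕ * 0#  ≈⟨ solve 2 (λ c α → ο :- c :* ο :- α :* ο := ο) refl cₕ αₕ ⟩
      0#                      ∎
      where
      cₕ = cc R q (suc (suc g))
      αₕ = αα R q (suc (suc g))

    sq : ℕ → Carrier
    sq n = q ^ (n *ℕ n)

    tri≈ : ∀ j → tri j ≈ q ^ triExp j
    tri≈ zero    = refl
    tri≈ (suc j) = trans (*-cong (t^≈q^ j) (tri≈ j)) (sym (^-+ q (2 *ℕ j) (triExp j)))

    top-summand : ∀ g j → K (suc g) j * sq (suc g ℕ.∸ j) ≈ sq (suc g) * (sgn j * (tri j * binom (suc g) j))
    top-summand g j with j ℕ.≤? suc g
    ... | yes j≤h = begin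
      (sgn j * (e * binom (suc g) j)) * sq b
        ≈⟨ solve 4 (λ s e B f → (s :* (e :* B)) :* f
                             := s :* ((e :* f) :* B)) refl (sgn j) e (binom (suc g) j) (sq b) ⟩
      sgn j * ((e * sq b) * binom (suc g) j)
        ≈⟨ *-congˡ (*-congʳ (trans (^-merge (j *ℕ suc (2 *ℕ g)) (b *ℕ b) (top-exponent g j b h≡j+b))
                                   (trans (^-+ q (suc g *ℕ suc g) (triExp j)) (*-congˡ (sym (tri≈ j)))))) ⟩
      sgn j * ((sq (suc g) * tri j) * binom (suc g) j)
        ≈⟨ solve 4 (λ s f τ B → s :* ((f :* τ) :* B)
                             := f :* (s :* (τ :* B))) refl (sgn j) (sq (suc g)) (tri j) (binom (suc g) j) ⟩
      sq (suc g) * (sgn j * (tri j * binom (suc g) j)) ∎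
      where
      e = q ^ (j *ℕ suc (2 *ℕ g))
      b = suc g ℕ.∸ j
      h≡j+b : suc g ≡.≡ j ℕ.+ b
      h≡j+b = ≡.sym (ℕP.m+[n∸m]≡n j≤h)
    ... | no j≰h = begin
      K (suc g) j * sq (suc g ℕ.∸ j)                    ≈⟨ *-congʳ (K-vanish h<j) ⟩
      0# * sq (suc g ℕ.∸ j)                              ≈⟨ zeroˡ _ ⟩
      0#                                                  ≈⟨ zeroʳ _ ⟨
      sq (suc g) * 0#                                     ≈⟨ *-congˡ summand-vanishes ⟨
      sq (suc g) * (sgn j * (tri j * binom (suc g) j))  ∎
      where
      h<j = ℕP.≰⇒> j≰h
      summand-vanishes : sgn j * (tri j * binom (suc g) j) ≈ 0#
      summand-vanishes = trans (*-congˡ (trans (*-congˡ (binom-vanish h<j)) (zeroʳ _))) (zeroʳ _)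

    -- The coefficient of z^h in Q_h · F vanishes (h ≥ 1): it is q^{h²} times the
    -- alternating sum of Gaussian binomials.
    top-coefficient : ∀ g → mulCoeff (Qpoly R q (suc g)) sq (suc g) ≈ 0#
    top-coefficient g = begin
      mulCoeff (Qpoly R q (suc g)) sq (suc g)
        ≈⟨ conv-as-Σ (Qpoly R q (suc g)) sq 0 (suc g) ⟩
      Σ⟨ suc g ⟩ (λ j → Qpoly R q (suc g) j * sq (suc g ℕ.∸ j))
        ≈⟨ Σ-cong (suc g) (λ j → trans (*-congʳ (Q-closed (suc g) j)) (top-summand g j)) ⟩
      Σ⟨ suc g ⟩ (λ j → sq (suc g) * (sgn j * (tri j * binom (suc g) j)))
        ≈⟨ Σ-distribˡ (suc g) (sq (suc g)) (λ j → sgn j * (tri j * binom (suc g) j)) ⟩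
      sq (suc g) * Σ⟨ suc g ⟩ (λ j → sgn j * (tri j * binom (suc g) j))
        ≈⟨ *-congˡ (alternating-sum g) ⟩
      sq (suc g) * 0#
        ≈⟨ zeroʳ _ ⟩
      0# ∎

    Agrees : ℕ → Set ℓ
    Agrees h = ∀ n → n < h → mulCoeff (Qpoly R q h) sq n ≈ Ppoly R q h n

    agrees-up-to : ∀ g → Agrees (suc g) →
                   ∀ n → n ≤ suc g → mulCoeff (Qpoly R q (suc g)) sq n ≈ Ppoly R q (suc g) n
    agrees-up-to g agree n n≤h with ℕP.m≤n⇒m<n∨m≡n n≤h
    ... | inj₁ n<h    = agree n n<h
    ... | inj₂ ≡.refl = trans (top-coefficient g) (sym (P-degree (suc g) (suc g) ℕP.≤-refl))

    -- Agreement below degree h propagates along the common recurrence of P_h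
    -- and Q_h, because [z^n] (X · F) is linear in X.
    agrees : ∀ h → Agrees h
    agrees zero          n       ()
    agrees (suc zero)    zero    _         = solve 0 (ı :* ı :+ ο := ı) refl
    agrees (suc zero)    (suc n) (s≤s ())
    agrees (suc (suc g)) n       n<h       = begin
      conv R (step R q (suc (suc g)) Q₁ Q₀) 0 (prefix sq n)
        ≈⟨ conv-linear Q₁ (shiftZ R Q₁) (shiftZ R (shiftZ R Q₀)) cₕ αₕ 0 (prefix sq n) ⟩
      mulCoeff Q₁ sq n - cₕ * mulCoeff (shiftZ R Q₁) sq n - αₕ * mulCoeff (shiftZ R (shiftZ R Q₀)) sq n
        ≈⟨ +-cong (+-cong (agrees-up-to g (agrees (suc g)) n (ℕP.≤-pred n<h))
                          (-‿cong (*-congˡ (shift-agrees Q₁ P₁ sq (suc g) (agrees (suc g)) n n<h))))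
                  (-‿cong (*-congˡ (shift-agrees (shiftZ R Q₀) (shiftZ R P₀) sq (suc g)
                                      (shift-agrees Q₀ P₀ sq g (agrees g)) n n<h))) ⟩
      P₁ n - cₕ * shiftZ R P₁ n - αₕ * shiftZ R (shiftZ R P₀) n ∎
      where
      Q₁ = Qpoly R q (suc g)
      Q₀ = Qpoly R q g
      P₁ = Ppoly R q (suc g)
      P₀ = Ppoly R q g
      cₕ = cc R q (suc (suc g))
      αₕ = αα R q (suc (suc g))

mainTheorem1 : ∀ {c ℓ : Level} (R : CommutativeRing c ℓ) →
    let open CommutativeRing R in
    (q : Carrier) → ¬ (q ≈ 0#) →
    (h n : ℕ) → 1 ≤ h → n ≤ h →
    convCoeff R q h n ≈ pow R q (n *ℕ n)
mainTheorem1 R q _ (suc g) n _ n≤h =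
  -- P_h / Q_h has the coefficients of F up to degree h, since Q_h(0) = 1 and Q_h · F ≡ P_h there
  Quotient.series≈ (Ppoly R q h) (Qpoly R q h) sq h (Q-constant h) (agrees-up-to g (agrees h)) n n≤h
  where
  open Development R
  open Convergents q
  h = suc g
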